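{- Let $G$ be a finite abelian group of order $n$, let $d\ge2$, let $S$ be the set of bijections $\{1,\dots,n\}\to G$, and let $\pi\in S$. Then the transversals of the Latin cube $L^d(G,\pi)$ are in bijection with the solutions of \[ \pi_1+\cdots+\pi_d=\pi\qquad(\pi_1,\dots,\pi_d\in S). \] In particular, if $T(L^d(G,\pi))$ denotes the number of transversals of $L^d(G,\pi)$, then $T(L^d(G,\pi))\,n!$ equals the number of solutions of $\pi_1+\cdots+\pi_d=\pi_{d+1}$ with $\pi_1,\dots,\pi_{d+1}\in S$.
   Context: Sums of functions $\{1,\dots,n\}\to G$ are pointwise. A Latin cube of dimension $d$ and order $n$ is a $d$-dimensional array indexed by $\{1,\dots,n\}^d$ with entries in $\{1,\dots,n\}$ such that no symbol occurs twice in any axis-parallel line (i.e. changing exactly one index changes the entry). A transversal is a set of $n$ cells, no two of which share the same value of the $j$-th index for any $j$ (no repeated hyperplane), and no two of which contain the same symbol. The Latin cube $L^d(G,\pi)$ is the array whose $(i_1,\dots,i_d)$-entry is $\pi^{ -1}(\pi(i_1)+\cdots+\pi(i_d))$. -}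

module Defs where

open import Level using (Level; _⊔_; 0ℓ)
open import Data.Nat.Base using (ℕ; zero; suc)
open import Data.Fin.Base using (Fin; zero; suc)
open import Data.Vec.Base using (Vec; lookup)
open import Data.Bool.Base using (Bool; true)
open import Data.Product.Base using (Σ; ∃-syntax; _×_; _,_; proj₁; proj₂)
open import Function.Base using (_∘_)
open import Function.Bundles using (Inverse)
open import Algebra.Bundles using (AbelianGroup)
open import Relation.Binary.Bundles using (Setoid)
open import Relation.Binary.PropositionalEquality as ≡ using (_≡_; _≢_)

Cell : ℕ → ℕ → Set
Cell n d = Vec (Fin n) d

-- A transversal of the d-dimensional array A of order n (symbols in Fin n):
-- a set of cells (given by its characteristic function `mem`) having exactly n
-- elements (witnessed by an injective enumeration Fin n → Cell onto it), no two
-- distinct of which agree in any index position j, nor carry the same symbol.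
record Transversal {n d : ℕ} (A : Cell n d → Fin n) : Set where
  field
    mem             : Cell n d → Bool
    enum            : Fin n → Cell n d
    enum-injective  : ∀ k l → enum k ≡ enum l → k ≡ l
    enum-sound      : ∀ k → mem (enum k) ≡ true
    enum-complete   : ∀ c → mem c ≡ true → ∃[ k ] enum k ≡ c
    distinct-index  : ∀ c c′ → mem c ≡ true → mem c′ ≡ true → c ≢ c′ →
                      ∀ j → lookup c j ≢ lookup c′ j
    distinct-symbol : ∀ c c′ → mem c ≡ true → mem c′ ≡ true → c ≢ c′ →
                      A c ≢ A c′

-- Transversals are sets of cells: two are equal iff they have the same cells.
TransversalSetoid : ∀ {n d} (A : Cell n d → Fin n) → Setoid 0ℓ 0ℓ
TransversalSetoid {n} {d} A = record
  { Carrier = Transversal A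
  ; _≈_ = λ T T′ → ∀ c → Transversal.mem T c ≡ Transversal.mem T′ c
  ; isEquivalence = record
    { refl = λ c → ≡.refl
    ; sym = λ p c → ≡.sym (p c)
    ; trans = λ p q c → ≡.trans (p c) (q c)
    }
  }

module _ {c ℓ : Level} (G : AbelianGroup c ℓ) where
  open AbelianGroup G

  S : ℕ → Set (c ⊔ ℓ)
  S n = Inverse (≡.setoid (Fin n)) setoid

  ⨁ : ∀ {d} → (Fin d → Carrier) → Carrier
  ⨁ {zero}  f = ε
  ⨁ {suc d} f = f zero ∙ ⨁ (f ∘ suc)

  L : ∀ {n} (d : ℕ) → S n → Cell n d → Fin n
  L d π cell = Inverse.from π (⨁ (λ j → Inverse.to π (lookup cell j)))

  SolutionSetoid : ∀ {n} (d : ℕ) → S n → Setoid (c ⊔ ℓ) ℓ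
  SolutionSetoid {n} d π = record
    { Carrier = Σ (Fin d → S n) λ ps →
                  ∀ i → ⨁ (λ j → Inverse.to (ps j) i) ≈ Inverse.to π i
    ; _≈_ = λ x y → ∀ j i → Inverse.to (proj₁ x j) i ≈ Inverse.to (proj₁ y j) i
    ; isEquivalence = record
      { refl = λ j i → refl
      ; sym = λ p j i → sym (p j i)
      ; trans = λ p q j i → trans (p j i) (q j i)
      }
    }

  FreeSolutionSetoid : (n d : ℕ) → Setoid (c ⊔ ℓ) ℓ
  FreeSolutionSetoid n d = record
    { Carrier = Σ (Fin d → S n) λ ps → Σ (S n) λ q →
                  ∀ i → ⨁ (λ j → Inverse.to (ps j) i) ≈ Inverse.to q i
    ; _≈_ = λ x y → (∀ j i → Inverse.to (proj₁ x j) i ≈ Inverse.to (proj₁ y j) i)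
                  × (∀ i → Inverse.to (proj₁ (proj₂ x)) i ≈ Inverse.to (proj₁ (proj₂ y)) i)
    ; isEquivalence = record
      { refl = (λ j i → refl) , (λ i → refl)
      ; sym = λ p → (λ j i → sym (proj₁ p j i)) , (λ i → sym (proj₂ p i))
      ; trans = λ p q → (λ j i → trans (proj₁ p j i) (proj₁ q j i))
                      , (λ i → trans (proj₂ p i) (proj₂ q i))
      }
    }

module Submission where

-- The proof separates the combinatorics of transversals from the group.
-- (1) For ANY d-dimensional array A of order n, a transversal is the same
--     thing as its "coordinates": permutations τ₁,…,τ_d of {1..n} such that
--     the cell (τ₁(s),…,τ_d(s)) carries symbol s for every symbol s.  Listing
--     the n cells of a transversal by their (distinct) symbols and reading off
--     each index gives injective, hence bijective, maps τ_j.
-- (2) For A = L^d(G,π) the coordinate condition reads π⁻¹(Σ_j π(τ_j s)) = s,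
--     i.e. Σ_j π∘τ_j = π; composing with π identifies permutations of
--     {1..n} with elements of S, so coordinates are exactly the solutions.
-- (3) A solution of π₁ + ⋯ + π_d = q can be relabelled by the permutation
--     q⁻¹∘π into a solution with right-hand side π, so the free solutions are
--     (solutions for π) × S; and S is in bijection with the n! permutations
--     of {1..n}, counted by peeling off the image of the first point.

open import Defs
open import Level using (Level; _⊔_; 0ℓ)
open import Data.Nat.Base using (ℕ; zero; suc; _≤_; _!)
open import Data.Nat.Properties using (n<1+n)
open import Data.Empty using (⊥-elim)
open import Data.Fin.Base using (Fin; zero; suc; punchOut; punchIn)
open import Data.Fin.Properties
  using (_≟_; any?; *↔×; punchOut-injective; punchOut-cong; <⇒notInjective)
open import Data.Fin.Permutation as Perm
  using (Permutation′; permutation; _⟨$⟩ʳ_; _⟨$⟩ˡ_; remove; insert; insert-remove; remove-insert)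
open import Data.Vec.Base using (lookup; tabulate)
open import Data.Vec.Properties using (lookup∘tabulate; tabulate∘lookup; tabulate-cong; ≡-dec)
open import Data.Bool.Base using (Bool; true)
open import Data.Bool.Properties using (⇔→≡)
open import Data.Product.Base using (Σ; ∃-syntax; _×_; _,_; proj₁; proj₂)
open import Data.Product.Relation.Binary.Pointwise.NonDependent using (_×ₛ_; Pointwise-≡↔≡)
open import Data.Product.Function.NonDependent.Setoid using (_×-inverse_)
open import Function.Base using (_∘_)
open import Function.Bundles using (Inverse; Injection; _⇔_; mk⇔; Equivalence)
open import Function.Properties.Inverse using (↔⇒↣)
open import Function.Definitions using (Injective)
import Function.Construct.Composition as Comp
import Function.Construct.Identity as Identity
import Function.Construct.Symmetry as Sym
open import Algebra.Bundles using (AbelianGroup)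
open import Relation.Binary.Bundles using (Setoid)
open import Relation.Binary.PropositionalEquality as ≡ using (_≡_; _≢_; setoid)
open import Relation.Nullary using (Dec; yes; no; does; contradiction)
open import Relation.Nullary.Decidable using (dec-true; does-⇔)

private
  variable
    a b ℓ₁ ℓ₂ : Level

InverseSetoid : (A : Setoid a ℓ₁) (B : Setoid b ℓ₂) → Setoid (a ⊔ b ⊔ ℓ₁ ⊔ ℓ₂) (a ⊔ ℓ₂)
InverseSetoid A B = record
  { Carrier = Inverse A B
  ; _≈_ = λ f g → ∀ x → Inverse.to f x ≈ Inverse.to g x
  ; isEquivalence = record
    { refl = λ _ → refl
    ; sym = λ h x → sym (h x)
    ; trans = λ h h′ x → trans (h x) (h′ x)
    }
  }
  where open Setoid B

Permutations : ℕ → Setoid 0ℓ 0ℓ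
Permutations n = InverseSetoid (setoid (Fin n)) (setoid (Fin n))

from-pointwise : {A : Setoid a ℓ₁} {B : Setoid b ℓ₂} (f g : Inverse A B) →
                 (∀ x → Setoid._≈_ B (Inverse.to f x) (Inverse.to g x)) →
                 ∀ y → Setoid._≈_ A (Inverse.from f y) (Inverse.from g y)
from-pointwise {A = A} {B = B} f g f≈g y =
  Setoid.sym A (Inverse.inverseʳ g (B.trans (B.sym (Inverse.inverseˡ f A.refl)) (f≈g _)))
  where
  module A = Setoid A
  module B = Setoid B

bijections↔permutations : {A : Setoid a ℓ₁} {B : Setoid b ℓ₂} (π : Inverse A B) →
                          Inverse (InverseSetoid A B) (InverseSetoid A A)
bijections↔permutations π = record
  { to = λ p → Comp.inverse p (Sym.inverse π)
  ; from = λ ρ → Comp.inverse ρ π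
  ; to-cong = λ p≈q x → Inverse.from-cong π (p≈q x)
  ; from-cong = λ ρ≈σ x → Inverse.to-cong π (ρ≈σ x)
  ; inverse = (λ p≈πρ x → Inverse.inverseʳ π (p≈πρ x))
            , (λ ρ≈π⁻¹p x → Inverse.inverseˡ π (ρ≈π⁻¹p x))
  }

-- An injective endomap of {1..n} is onto: an unhit point y would let
-- k ↦ punchOut (f k ≢ y) inject {1..n} into {1..n-1}.
injective⇒surjective : ∀ {n} (f : Fin n → Fin n) → Injective _≡_ _≡_ f →
                       ∀ y → ∃[ x ] f x ≡ y
injective⇒surjective {suc m} f f-inj y with any? (λ x → f x ≟ y)
... | yes hit = hit
... | no miss = ⊥-elim (<⇒notInjective (n<1+n m) squeeze-injective)
  where
  misses : ∀ x → y ≢ f x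
  misses x y≡fx = miss (x , ≡.sym y≡fx)
  squeeze : Fin (suc m) → Fin m
  squeeze x = punchOut (misses x)
  squeeze-injective : Injective _≡_ _≡_ squeeze
  squeeze-injective e = f-inj (punchOut-injective (misses _) (misses _) e)

injective⇒permutation : ∀ {n} (f : Fin n → Fin n) → Injective _≡_ _≡_ f → Permutation′ n
injective⇒permutation f f-inj =
  permutation f (λ y → proj₁ (surj y)) (λ y → proj₂ (surj y)) (λ x → f-inj (proj₂ (surj (f x))))
  where surj = injective⇒surjective f f-inj

remove-cong : ∀ {m} (i : Fin (suc m)) {ρ σ : Permutation′ (suc m)} →
              ρ Perm.≈ σ → remove i ρ Perm.≈ remove i σ
remove-cong i {ρ} {σ} ρ≈σ k = punchOut-both (ρ≈σ i) (ρ≈σ (punchIn i k))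
  where
  punchOut-both : ∀ {m} {x x′ y y′ : Fin (suc m)} {x≢y : x ≢ y} {x′≢y′ : x′ ≢ y′} →
                  x ≡ x′ → y ≡ y′ → punchOut x≢y ≡ punchOut x′≢y′
  punchOut-both {x = x} ≡.refl y≡y′ = punchOut-cong x y≡y′

insert-cong : ∀ {m} (i j : Fin (suc m)) {ρ σ : Permutation′ m} →
              ρ Perm.≈ σ → insert i j ρ Perm.≈ insert i j σ
insert-cong i j ρ≈σ k with i ≟ k
... | yes _ = ≡.refl
... | no i≢k = ≡.cong (punchIn j) (ρ≈σ (punchOut i≢k))

peel : ∀ m → Inverse (Permutations (suc m)) (setoid (Fin (suc m)) ×ₛ Permutations m)
peel m = record
  { to = λ ρ → ρ ⟨$⟩ʳ zero , remove zero ρ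
  ; from = λ (j , σ) → insert zero j σ
  ; to-cong = λ {ρ} {σ} ρ≈σ → ρ≈σ zero , remove-cong zero {ρ} {σ} ρ≈σ
  ; from-cong = λ { {j , ρ} {.j , σ} (≡.refl , ρ≈σ) → insert-cong zero j {ρ} {σ} ρ≈σ }
  ; inverse = (λ { {j , σ} {ρ} ρ≈ins → ρ≈ins zero
                 , λ k → ≡.trans (remove-cong zero {ρ} {insert zero j σ} ρ≈ins k)
                                 (remove-insert zero j σ k) })
            , (λ { {ρ} {j , σ} (j≡ρ0 , σ≈rem) k →
                 ≡.trans (insert-both j≡ρ0 σ≈rem k) (insert-remove zero ρ k) })
  }
  where
  insert-both : ∀ {j j′ σ σ′} → j ≡ j′ → σ Perm.≈ σ′ → insert zero j σ Perm.≈ insert zero j′ σ′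
  insert-both {j} ≡.refl = insert-cong zero j

permutations↔factorial : ∀ n → Inverse (Permutations n) (setoid (Fin (n !)))
permutations↔factorial zero = record
  { to = λ _ → zero
  ; from = λ _ → Perm.id
  ; to-cong = λ _ → ≡.refl
  ; from-cong = λ _ ()
  ; inverse = (λ { {zero} _ → ≡.refl }) , (λ _ ())
  }
permutations↔factorial (suc m) =
  Comp.inverse (peel m)
  (Comp.inverse (Identity.inverse (setoid (Fin (suc m))) ×-inverse permutations↔factorial m)
  (Comp.inverse Pointwise-≡↔≡ (Sym.inverse *↔×)))

cellAt : ∀ {n d} → (Fin d → Permutation′ n) → Fin n → Cell n d
cellAt τ s = tabulate (λ j → τ j ⟨$⟩ʳ s)

module TransversalCoordinates {n d : ℕ} (A : Cell n d → Fin n) where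

  _≟ᶜ_ : (c c′ : Cell n d) → Dec (c ≡ c′)
  _≟ᶜ_ = ≡-dec _≟_

  CoordinateSetoid : Setoid 0ℓ 0ℓ
  CoordinateSetoid = record
    { Carrier = Σ (Fin d → Permutation′ n) λ τ → ∀ s → A (cellAt τ s) ≡ s
    ; _≈_ = λ (τ , _) (τ′ , _) → ∀ j s → τ j ⟨$⟩ʳ s ≡ τ′ j ⟨$⟩ʳ s
    ; isEquivalence = record
      { refl = λ j s → ≡.refl
      ; sym = λ h j s → ≡.sym (h j s)
      ; trans = λ h h′ j s → ≡.trans (h j s) (h′ j s)
      }
    }

  Coordinates : Set
  Coordinates = Setoid.Carrier CoordinateSetoid

  module OfTransversal (T : Transversal A) where
    open Transversal T

    -- Distinct cells of T differ in every index and in their symbol, so both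
    -- the symbol and each index of the k-th cell determine k.
    index-injective : ∀ j → Injective _≡_ _≡_ (λ k → lookup (enum k) j)
    index-injective j {k} {l} same-index with k ≟ l
    ... | yes k≡l = k≡l
    ... | no k≢l = contradiction same-index
      (distinct-index _ _ (enum-sound k) (enum-sound l) (k≢l ∘ enum-injective k l) j)

    symbol-injective : Injective _≡_ _≡_ (A ∘ enum)
    symbol-injective {k} {l} same-symbol with k ≟ l
    ... | yes k≡l = k≡l
    ... | no k≢l = contradiction same-symbol
      (distinct-symbol _ _ (enum-sound k) (enum-sound l) (k≢l ∘ enum-injective k l))

    symbols : Permutation′ n
    symbols = injective⇒permutation (A ∘ enum) symbol-injective

    cellOf : Fin n → Cell n d
    cellOf s = enum (symbols ⟨$⟩ˡ s)

    cellOf-symbol : ∀ s → A (cellOf s) ≡ s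
    cellOf-symbol s = Perm.inverseʳ symbols

    cellOf-mem : ∀ s → mem (cellOf s) ≡ true
    cellOf-mem s = enum-sound _

    cellOf-unique : ∀ c → mem c ≡ true → c ≡ cellOf (A c)
    cellOf-unique c c∈T with enum-complete c c∈T
    ... | k , ≡.refl = ≡.cong enum (≡.sym (Perm.inverseˡ symbols))

    mem⇔cellOf : ∀ c → (mem c ≡ true) ⇔ (∃[ s ] c ≡ cellOf s)
    mem⇔cellOf c = mk⇔ (λ c∈T → A c , cellOf-unique c c∈T)
                       (λ { (s , ≡.refl) → cellOf-mem s })

    coordinate : Fin d → Permutation′ n
    coordinate j = injective⇒permutation (λ s → lookup (cellOf s) j) injective
      where
      injective : Injective _≡_ _≡_ (λ s → lookup (cellOf s) j)
      injective {s} {s′} same-index = begin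
        s                   ≡⟨ ≡.sym (cellOf-symbol s) ⟩
        A (cellOf s)        ≡⟨ ≡.cong (A ∘ enum) (index-injective j same-index) ⟩
        A (cellOf s′)       ≡⟨ cellOf-symbol s′ ⟩
        s′                  ∎
        where open ≡.≡-Reasoning

    cellAt-coordinate : ∀ s → cellAt coordinate s ≡ cellOf s
    cellAt-coordinate s = tabulate∘lookup (cellOf s)

    coordinates : Coordinates
    coordinates = coordinate , λ s → ≡.trans (≡.cong A (cellAt-coordinate s)) (cellOf-symbol s)

  cellOf-cong : ∀ (T T′ : Transversal A) →
                (∀ c → Transversal.mem T c ≡ true → Transversal.mem T′ c ≡ true) →
                ∀ s → OfTransversal.cellOf T s ≡ OfTransversal.cellOf T′ s
  cellOf-cong T T′ T⊆T′ s = begin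
    T.cellOf s                     ≡⟨ T′.cellOf-unique _ (T⊆T′ _ (T.cellOf-mem s)) ⟩
    T′.cellOf (A (T.cellOf s))     ≡⟨ ≡.cong T′.cellOf (T.cellOf-symbol s) ⟩
    T′.cellOf s                    ∎
    where
    module T = OfTransversal T
    module T′ = OfTransversal T′
    open ≡.≡-Reasoning

  module OfCoordinates (x : Coordinates) where
    τ = proj₁ x
    cell = cellAt τ

    cell-symbol : ∀ s → A (cell s) ≡ s
    cell-symbol = proj₂ x

    cell-injective : ∀ s s′ → cell s ≡ cell s′ → s ≡ s′
    cell-injective s s′ e = ≡.trans (≡.sym (cell-symbol s)) (≡.trans (≡.cong A e) (cell-symbol s′))

    index : ∀ s j → lookup (cell s) j ≡ τ j ⟨$⟩ʳ s
    index s j = lookup∘tabulate _ j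

    mem : Cell n d → Bool
    mem c = does (any? λ s → c ≟ᶜ cell s)

    mem⇔cell : ∀ c → (mem c ≡ true) ⇔ (∃[ s ] c ≡ cell s)
    mem⇔cell c = mk⇔ (holds (any? λ s → c ≟ᶜ cell s)) (dec-true (any? λ s → c ≟ᶜ cell s))
      where
      holds : ∀ {P : Set} (P? : Dec P) → does P? ≡ true → P
      holds (yes p) _ = p
      holds (no _) ()

    cell-of : ∀ {c} → mem c ≡ true → ∃[ s ] c ≡ cell s
    cell-of = Equivalence.to (mem⇔cell _)

    distinct-index : ∀ c c′ → mem c ≡ true → mem c′ ≡ true → c ≢ c′ →
                     ∀ j → lookup c j ≢ lookup c′ j
    distinct-index c c′ c∈ c′∈ c≢c′ j same-index
      with cell-of c∈ | cell-of c′∈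
    ... | s , ≡.refl | s′ , ≡.refl = c≢c′ (≡.cong cell (Injection.injective (↔⇒↣ (τ j)) (begin
      τ j ⟨$⟩ʳ s           ≡⟨ ≡.sym (index s j) ⟩
      lookup (cell s) j    ≡⟨ same-index ⟩
      lookup (cell s′) j   ≡⟨ index s′ j ⟩
      τ j ⟨$⟩ʳ s′          ∎)))
      where open ≡.≡-Reasoning

    distinct-symbol : ∀ c c′ → mem c ≡ true → mem c′ ≡ true → c ≢ c′ → A c ≢ A c′
    distinct-symbol c c′ c∈ c′∈ c≢c′ same-symbol
      with cell-of c∈ | cell-of c′∈
    ... | s , ≡.refl | s′ , ≡.refl =
      c≢c′ (≡.cong cell (≡.trans (≡.sym (cell-symbol s)) (≡.trans same-symbol (cell-symbol s′))))

    transversal : Transversal A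
    transversal = record
      { mem = mem
      ; enum = cell
      ; enum-injective = cell-injective
      ; enum-sound = λ s → Equivalence.from (mem⇔cell _) (s , ≡.refl)
      ; enum-complete = λ c c∈ → let s , c≡ = cell-of c∈ in s , ≡.sym c≡
      ; distinct-index = distinct-index
      ; distinct-symbol = distinct-symbol
      }

    cellOf-transversal : ∀ s → OfTransversal.cellOf transversal s ≡ cell s
    cellOf-transversal s = ≡.sym (≡.trans
      (OfTransversal.cellOf-unique transversal (cell s) (Equivalence.from (mem⇔cell _) (s , ≡.refl)))
      (≡.cong (OfTransversal.cellOf transversal) (cell-symbol s)))

  transversal↔coordinates : Inverse (TransversalSetoid A) CoordinateSetoid
  transversal↔coordinates = record
    { to = OfTransversal.coordinates
    ; from = OfCoordinates.transversal
    ; to-cong = λ {T} {T′} T≈T′ j s →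
        ≡.cong (λ c → lookup c j) (cellOf-cong T T′ (λ c c∈T → ≡.trans (≡.sym (T≈T′ c)) c∈T) s)
    ; from-cong = λ {x} {y} x≈y c →
        does-⇔ (same-cells x y x≈y c) (any? λ s → c ≟ᶜ cellAt (proj₁ x) s)
                                      (any? λ s → c ≟ᶜ cellAt (proj₁ y) s)
    ; inverse = (λ {x} {T} → coordinates-of-transversal x T)
              , (λ {T} {x} → transversal-of-coordinates T x)
    }
    where
    same-cells : ∀ x y → (∀ j s → proj₁ x j ⟨$⟩ʳ s ≡ proj₁ y j ⟨$⟩ʳ s) →
                 ∀ c → (∃[ s ] c ≡ cellAt (proj₁ x) s) ⇔ (∃[ s ] c ≡ cellAt (proj₁ y) s)
    same-cells x y x≈y c = mk⇔ (λ (s , e) → s , ≡.trans e (cellAt≡ s))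
                               (λ (s , e) → s , ≡.trans e (≡.sym (cellAt≡ s)))
      where
      cellAt≡ : ∀ s → cellAt (proj₁ x) s ≡ cellAt (proj₁ y) s
      cellAt≡ s = tabulate-cong (λ j → x≈y j s)

    coordinates-of-transversal : ∀ x T → (∀ c → Transversal.mem T c ≡ OfCoordinates.mem x c) →
                                 ∀ j s → lookup (OfTransversal.cellOf T s) j ≡ proj₁ x j ⟨$⟩ʳ s
    coordinates-of-transversal x T T≈x j s = begin
      lookup (OfTransversal.cellOf T s) j
        ≡⟨ ≡.cong (λ c → lookup c j) (cellOf-cong T X.transversal (λ c c∈T → ≡.trans (≡.sym (T≈x c)) c∈T) s) ⟩
      lookup (OfTransversal.cellOf X.transversal s) j
        ≡⟨ ≡.cong (λ c → lookup c j) (X.cellOf-transversal s) ⟩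
      lookup (X.cell s) j
        ≡⟨ X.index s j ⟩
      proj₁ x j ⟨$⟩ʳ s ∎
      where
      module X = OfCoordinates x
      open ≡.≡-Reasoning

    transversal-of-coordinates : ∀ T x → (∀ j s → proj₁ x j ⟨$⟩ʳ s ≡ lookup (OfTransversal.cellOf T s) j) →
                                 ∀ c → OfCoordinates.mem x c ≡ Transversal.mem T c
    transversal-of-coordinates T x x≈T c = ⇔→≡ (mk⇔
      (λ c∈x → Equivalence.from (T.mem⇔cellOf c) (let s , e = X.cell-of c∈x in s , ≡.trans e (cell≡ s)))
      (λ c∈T → Equivalence.from (X.mem⇔cell c)
        (let s , e = Equivalence.to (T.mem⇔cellOf c) c∈T in s , ≡.trans e (≡.sym (cell≡ s)))))
      where
      module X = OfCoordinates x
      module T = OfTransversal T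
      cell≡ : ∀ s → X.cell s ≡ T.cellOf s
      cell≡ s = ≡.trans (tabulate-cong (λ j → x≈T j s)) (tabulate∘lookup (T.cellOf s))

module LatinCube {c ℓ : Level} (G : AbelianGroup c ℓ) where
  open AbelianGroup G hiding (setoid)
  open TransversalCoordinates using (CoordinateSetoid; transversal↔coordinates)

  Bijections : ℕ → Setoid (c ⊔ ℓ) ℓ
  Bijections n = InverseSetoid (setoid (Fin n)) (AbelianGroup.setoid G)

  ⨁-cong : ∀ {d} {f g : Fin d → Carrier} → (∀ j → f j ≈ g j) → ⨁ G f ≈ ⨁ G g
  ⨁-cong {zero} f≈g = refl
  ⨁-cong {suc d} f≈g = ∙-cong (f≈g zero) (⨁-cong (f≈g ∘ suc))

  bijections↔factorial : ∀ {n} → S G n → Inverse (Bijections n) (setoid (Fin (n !)))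
  bijections↔factorial {n} π = Comp.inverse (bijections↔permutations π) (permutations↔factorial n)

  module _ {n d : ℕ} (π : S G n) where
    private
      module π = Inverse π
      bij : Inverse (Bijections n) (Permutations n)
      bij = bijections↔permutations π

    L-cellAt : ∀ (τ : Fin d → Permutation′ n) s →
               L G d π (cellAt τ s) ≡ π.from (⨁ G (λ j → π.to (τ j ⟨$⟩ʳ s)))
    L-cellAt τ s =
      π.from-cong (⨁-cong {d} (λ j → reflexive (≡.cong π.to (lookup∘tabulate (λ j → τ j ⟨$⟩ʳ s) j))))

    coordinates↔solutions : Inverse (CoordinateSetoid (L G d π)) (SolutionSetoid G d π)
    coordinates↔solutions = record
      { to = λ (τ , τ-symbol) → (λ j → Inverse.from bij (τ j)) , solves τ τ-symbol
      ; from = λ (ps , ps-solve) → (λ j → Inverse.to bij (ps j)) , symbol ps ps-solve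
      ; to-cong = λ {x} {y} τ≈σ j → Inverse.from-cong bij {proj₁ x j} {proj₁ y j} (τ≈σ j)
      ; from-cong = λ {x} {y} p≈q j → Inverse.to-cong bij {proj₁ x j} {proj₁ y j} (p≈q j)
      ; inverse = (λ {x} {y} τ≈π⁻¹p j → Inverse.inverseʳ bij {proj₁ x j} {proj₁ y j} (τ≈π⁻¹p j))
                , (λ {x} {y} p≈πτ j → Inverse.inverseˡ bij {proj₁ x j} {proj₁ y j} (p≈πτ j))
      }
      where
      solves : ∀ τ → (∀ s → L G d π (cellAt τ s) ≡ s) →
               ∀ s → ⨁ G (λ j → π.to (τ j ⟨$⟩ʳ s)) ≈ π.to s
      solves τ τ-symbol s = sym (π.inverseˡ (≡.sym (≡.trans (≡.sym (L-cellAt τ s)) (τ-symbol s))))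

      symbol : ∀ (ps : Fin d → S G n) → (∀ s → ⨁ G (λ j → Inverse.to (ps j) s) ≈ π.to s) →
               ∀ s → L G d π (cellAt (λ j → Inverse.to bij (ps j)) s) ≡ s
      symbol ps ps-solve s = ≡.trans (L-cellAt (λ j → Inverse.to bij (ps j)) s)
        (π.inverseʳ (trans (⨁-cong {d} (λ j → π.inverseˡ ≡.refl)) (ps-solve s)))

    -- (3) Relabelling by q⁻¹ ∘ π turns a solution of π₁ + ⋯ + π_d = q into one
    -- with right-hand side π; so free solutions are pairs (solution for π, q).
    free↔solutions×bijections : Inverse (FreeSolutionSetoid G n d)
                                        (SolutionSetoid G d π ×ₛ Bijections n)
    free↔solutions×bijections = record
      { to = λ (ps , q , e) →
          ((λ j → Comp.inverse (relabel q) (ps j)) , λ s → trans (e _) (Inverse.inverseˡ q ≡.refl)) , q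
      ; from = λ ((ps , e) , q) →
          (λ j → Comp.inverse (unlabel q) (ps j)) , q , λ s → trans (e _) (π.inverseˡ ≡.refl)
      ; to-cong = λ { {ps , q , _} {ps′ , q′ , _} (ps≈ps′ , q≈q′) →
          (λ j s → trans (reflexive (≡.cong (Inverse.to (ps j)) (from-pointwise q q′ q≈q′ _)))
                         (ps≈ps′ j _))
          , q≈q′ }
      ; from-cong = λ { {(ps , _) , q} {(ps′ , _) , q′} (ps≈ps′ , q≈q′) →
          (λ j s → trans (reflexive (≡.cong (Inverse.to (ps j)) (π.from-cong (q≈q′ s))))
                         (ps≈ps′ j _))
          , q≈q′ }
      ; inverse = (λ { {(ps′ , _) , q′} {ps , q , _} (ps≈ , q≈q′) →
                       (λ j s → trans (ps≈ j _)
                                      (reflexive (≡.cong (Inverse.to (ps′ j)) (relabel-unlabel q q′ q≈q′ s))))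
                       , q≈q′ })
                , (λ { {ps , q , _} {(ps′ , _) , q′} (ps′≈ , q′≈q) →
                       (λ j s → trans (ps′≈ j _)
                                      (reflexive (≡.cong (Inverse.to (ps j)) (unlabel-relabel q q′ q′≈q s))))
                       , q′≈q })
      }
      where
      relabel unlabel : S G n → Permutation′ n
      relabel q = Comp.inverse π (Sym.inverse q)
      unlabel q = Comp.inverse q (Sym.inverse π)

      relabel-unlabel : ∀ q q′ → (∀ i → Inverse.to q i ≈ Inverse.to q′ i) →
                        ∀ s → unlabel q′ ⟨$⟩ʳ (relabel q ⟨$⟩ʳ s) ≡ s
      relabel-unlabel q q′ q≈q′ s = π.inverseʳ (trans (sym (q≈q′ _)) (Inverse.inverseˡ q ≡.refl))

      unlabel-relabel : ∀ q q′ → (∀ i → Inverse.to q′ i ≈ Inverse.to q i) →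
                        ∀ s → relabel q ⟨$⟩ʳ (unlabel q′ ⟨$⟩ʳ s) ≡ s
      unlabel-relabel q q′ q′≈q s = Inverse.inverseʳ q (trans (π.inverseˡ ≡.refl) (q′≈q s))

    transversals↔solutions : Inverse (TransversalSetoid (L G d π)) (SolutionSetoid G d π)
    transversals↔solutions = Comp.inverse (transversal↔coordinates (L G d π)) coordinates↔solutions

-- Lemma 7.1: the bijection (1)+(2), and (1)+(2) combined with (3):
--   T × Fin(n!) ≅ Solutions(π) × S ≅ FreeSolutions.
lemma7p1 : ∀ {c ℓ : Level} (G : AbelianGroup c ℓ) (n d : ℕ) → 2 ≤ d → (π : S G n) →
    Inverse (TransversalSetoid (L G d π)) (SolutionSetoid G d π)
    × Inverse (TransversalSetoid (L G d π) ×ₛ setoid (Fin (n !))) (FreeSolutionSetoid G n d)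
lemma7p1 G n d _ π =
  transversals↔solutions π ,
  Comp.inverse (transversals↔solutions π ×-inverse Sym.inverse (bijections↔factorial π))
               (Sym.inverse (free↔solutions×bijections π))
  where open LatinCube G
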